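{- Let $n\ge5$ and let $\widetilde{D}_n$ be labeled on $[n+1]$ with edges $\{1,2\},\{1,3\},\{1,4\}$, $\{i,i+1\}$ for $4\le i\le n-2$, $\{n-1,n\}$, $\{n-1,n+1\}$. Let $\tau$ be the involution of $[n+1]$ swapping $n\leftrightarrow n+1$ and fixing all $i\le n-1$. Let $Q$ be a quiver of type $\widetilde{D}_n$ invariant under $\tau$, with adjacency matrix $B=(b_{i,j})$. Then for all $i,j\in[n+1]$, $b_{i,j}b_{i,\tau(j)}\ge0$.
   Context: A quiver on $[N]$ is a finite directed multigraph with vertex set $[N]$ without loops and directed $2$-cycles; adjacency matrix $b_{i,j}=$ #(arrows $i\to j$) $-$ #(arrows $j\to i$). Mutation $\mu_k$: $b'_{i,j}=-b_{i,j}$ if $k\in\{i,j\}$, else $b'_{i,j}=b_{i,j}+\frac{|b_{i,k}|b_{k,j}+b_{i,k}|b_{k,j}|}{2}$. $Q$ is of type $\widetilde{D}_n$ (with this labeling) if it is mutation equivalent to an acyclic quiver whose underlying graph is the labeled tree above. $Q$ is invariant under $\tau$ if $b_{\tau(i),\tau(j)}=b_{i,j}$ for all $i,j$. -}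

module Defs where

open import Data.Nat as ℕ using (ℕ; zero; suc; _∸_)
open import Data.Nat.Properties using (m∸n≤m)
open import Data.Integer as ℤ using (ℤ; +_; ∣_∣; -_; _*_; _+_; 0ℤ)
open import Data.Integer.DivMod using (_/ℕ_)
open import Data.Fin using (Fin; toℕ; fromℕ; fromℕ<; _≟_)
open import Data.Product using (_×_; Σ)
open import Data.Sum using (_⊎_)
open import Relation.Nullary using (¬_; yes; no)
open import Relation.Binary.PropositionalEquality using (_≡_)

-- A quiver on [N] is represented by its adjacency matrix
-- b i j = #(i → j) - #(j → i); vertex k ∈ [N] is the index k-1 : Fin N.
Matrix : ℕ → Set
Matrix N = Fin N → Fin N → ℤ

-- Adjacency matrices of quivers (no loops, no 2-cycles) are exactly the
-- skew-symmetric integer matrices.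
IsQuiver : ∀ {N} → Matrix N → Set
IsQuiver {N} b = ∀ (i j : Fin N) → b j i ≡ - b i j

μ : ∀ {N} → Fin N → Matrix N → Matrix N
μ k b i j with i ≟ k | j ≟ k
... | yes _ | _     = - b i j
... | no _  | yes _ = - b i j
... | no _  | no _  =
  b i j + ((+ ∣ b i k ∣) * b k j + b i k * (+ ∣ b k j ∣)) /ℕ 2

-- Mutation equivalence: reflexive-transitive closure of single mutations
-- (mutations are involutive, so this is symmetric).
data MutEquiv {N} : Matrix N → Matrix N → Set where
  done : ∀ {b} → MutEquiv b b
  step : ∀ {b c} (k : Fin N) → MutEquiv (μ k b) c → MutEquiv b c

TreeEdge₀ : ℕ → ℕ → ℕ → Set
TreeEdge₀ n a c =
    (a ≡ 1 × (c ≡ 2 ⊎ c ≡ 3 ⊎ c ≡ 4))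
  ⊎ (4 ℕ.≤ a × a ℕ.≤ n ∸ 2 × c ≡ suc a)
  ⊎ (a ≡ n ∸ 1 × (c ≡ n ⊎ c ≡ suc n))

TreeEdge : (n : ℕ) → Fin (suc n) → Fin (suc n) → Set
TreeEdge n i j = TreeEdge₀ n (suc (toℕ i)) (suc (toℕ j))
               ⊎ TreeEdge₀ n (suc (toℕ j)) (suc (toℕ i))

-- A quiver whose underlying graph is the labeled tree D̃_n (each tree
-- edge is a single arrow, no other arrows).  Such a quiver is
-- automatically acyclic, since its underlying graph is a tree.
IsTreeQuiver : (n : ℕ) → Matrix (suc n) → Set
IsTreeQuiver n b = IsQuiver b
  × (∀ i j → TreeEdge n i j → ∣ b i j ∣ ≡ 1)
  × (∀ i j → ¬ TreeEdge n i j → b i j ≡ 0ℤ)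

IsTypeD̃ : (n : ℕ) → Matrix (suc n) → Set
IsTypeD̃ n b = Σ (Matrix (suc n)) λ a → IsTreeQuiver n a × MutEquiv b a

-- τ swaps labels n and n+1 (indices n-1 and n), fixes the rest.
τ : (n : ℕ) → Fin (suc n) → Fin (suc n)
τ n i with i ≟ fromℕ n | i ≟ fromℕ< {n ∸ 1} (ℕ.s≤s (m∸n≤m n 1))
... | yes _ | _     = fromℕ< {n ∸ 1} (ℕ.s≤s (m∸n≤m n 1))
... | no _  | yes _ = fromℕ n
... | no _  | no _  = i

IsInvariant : ∀ {N} → (Fin N → Fin N) → Matrix N → Set
IsInvariant {N} t b = ∀ (i j : Fin N) → b (t i) (t j) ≡ b i j

{-# OPTIONS --safe #-}
-- If j is fixed by τ the product b i j * b i (τ j) is a square; if i is fixed,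
-- invariance gives b i (τ j) = b (τ i) (τ j) = b i j, so it is a square again.
-- Otherwise i, j ∈ {n, n+1}, so j = i or τ j = i and one factor is a diagonal
-- entry of the skew-symmetric matrix b, hence zero.
module Submission where

open import Defs
open import Data.Nat using (ℕ; suc; _≤_)
open import Data.Integer using (_*_; 0ℤ) renaming (_≤_ to _≤ℤ_)
open import Data.Fin using (Fin)

open import Data.Nat as ℕ using (_∸_)
open import Data.Nat.Properties using (m∸n≤m)
open import Data.Integer as ℤ using (+_; -[1+_]; -_)
open import Data.Integer.Properties using (*-zeroʳ; +◃n≡+n)
open import Data.Fin using (fromℕ; fromℕ<; _≟_)
open import Data.Product using (_×_; _,_)
open import Data.Sum using (_⊎_; inj₁; inj₂)
open import Relation.Nullary using (yes; no; contradiction)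
open import Relation.Binary.PropositionalEquality

private
  variable
    N : ℕ

0≤i*i : ∀ i → 0ℤ ≤ℤ i * i
0≤i*i (+ k) rewrite +◃n≡+n (k ℕ.* k) = ℤ.+≤+ ℕ.z≤n
0≤i*i -[1+ k ] = ℤ.+≤+ ℕ.z≤n

i≡-i⇒i≡0 : ∀ {i} → i ≡ - i → i ≡ 0ℤ
i≡-i⇒i≡0 {+ ℕ.zero} _ = refl

IsQuiver⇒diagonal≡0 : {b : Matrix N} → IsQuiver b → ∀ x → b x x ≡ 0ℤ
IsQuiver⇒diagonal≡0 {b = b} skew x = i≡-i⇒i≡0 (skew x x)

MovesAtMostAPair : (Fin N → Fin N) → Set
MovesAtMostAPair t = ∀ x y → t x ≢ x → t y ≢ y → y ≡ x ⊎ t y ≡ x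

invariant-product-nonneg :
  ∀ {b : Matrix N} {t : Fin N → Fin N} → IsQuiver b → IsInvariant t b →
  MovesAtMostAPair t → ∀ i j → 0ℤ ≤ℤ b i j * b i (t j)
invariant-product-nonneg {b = b} {t} skew inv pair i j with t j ≟ j | t i ≟ i
... | yes tj≡j | _ rewrite tj≡j = 0≤i*i (b i j)
... | no _ | yes ti≡i = subst (λ z → 0ℤ ≤ℤ z * b i (t j)) b[i,tj]≡b[i,j] (0≤i*i (b i (t j)))
  where
  open ≡-Reasoning
  b[i,tj]≡b[i,j] : b i (t j) ≡ b i j
  b[i,tj]≡b[i,j] = begin
    b i (t j)     ≡⟨ cong (λ x → b x (t j)) (sym ti≡i) ⟩
    b (t i) (t j) ≡⟨ inv i j ⟩
    b i j         ∎
... | no tj≢j | no ti≢i with pair i j ti≢i tj≢j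
...   | inj₁ refl rewrite IsQuiver⇒diagonal≡0 skew i = ℤ.+≤+ ℕ.z≤n
...   | inj₂ tj≡i rewrite tj≡i | IsQuiver⇒diagonal≡0 skew i | *-zeroʳ (b i j) =
  ℤ.+≤+ ℕ.z≤n

module _ (n : ℕ) where
  private
    last penultimate : Fin (suc n)
    last = fromℕ n
    penultimate = fromℕ< {n ∸ 1} (ℕ.s≤s (m∸n≤m n 1))

  τ-cases : ∀ x → (x ≡ last × τ n x ≡ penultimate)
                ⊎ (x ≡ penultimate × τ n x ≡ last)
                ⊎ τ n x ≡ x
  τ-cases x with x ≟ last | x ≟ penultimate
  ... | yes x≡l | _       = inj₁ (x≡l , refl)
  ... | no _    | yes x≡p = inj₂ (inj₁ (x≡p , refl))
  ... | no _    | no _    = inj₂ (inj₂ refl)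

  τ-movesAtMostAPair : MovesAtMostAPair (τ n)
  τ-movesAtMostAPair x y τx≢x τy≢y with τ-cases x | τ-cases y
  ... | inj₂ (inj₂ τx≡x)       | _                       = contradiction τx≡x τx≢x
  ... | _                      | inj₂ (inj₂ τy≡y)        = contradiction τy≡y τy≢y
  ... | inj₁ (refl , _)        | inj₁ (refl , _)         = inj₁ refl
  ... | inj₁ (refl , _)        | inj₂ (inj₁ (refl , τy)) = inj₂ τy
  ... | inj₂ (inj₁ (refl , _)) | inj₁ (refl , τy)        = inj₂ τy
  ... | inj₂ (inj₁ (refl , _)) | inj₂ (inj₁ (refl , _))  = inj₁ refl

lemma4p17 : (n : ℕ) → 5 ≤ n → (b : Matrix (suc n)) → IsQuiver b → IsTypeD̃ n b → IsInvariant (τ n) b → (i j : Fin (suc n)) → 0ℤ ≤ℤ b i j * b i (τ n j)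
lemma4p17 n _ b skew _ inv =
  invariant-product-nonneg skew inv (τ-movesAtMostAPair n)
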